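{- Let $k \geq 2$, $n \geq 2$, $\lambda \geq 1$ and $m \geq 1$ be integers. If there is an orthogonal array $\mathrm{OA}_{\lambda}(k,n)$ containing a row that is repeated $m$ times, then \[m \leq \frac{\lambda n^2}{k(n-1)+1}.\]
   Context: An orthogonal array $\mathrm{OA}_{\lambda}(k,n)$ (of strength two) is a $\lambda n^2$ by $k$ array $A$ with entries from a set $X$ of cardinality $n$ such that, within any two columns of $A$, every ordered pair of symbols from $X$ occurs in exactly $\lambda$ rows of $A$. -}

module Defs where

open import Data.Nat using (ℕ; _*_)
open import Data.Fin using (Fin)
open import Data.Fin.Properties using (_≟_)
open import Data.Vec using (Vec; lookup)
open import Data.Vec.Properties using (≡-dec)
open import Data.List using (List; length; filter)
open import Data.List.Base using (allFin)
open import Data.Product using (_×_)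
open import Relation.Binary.PropositionalEquality using (_≡_; _≢_)
open import Relation.Nullary.Decidable using (_×-dec_)

Array : ℕ → ℕ → ℕ → Set
Array N k n = Fin N → Vec (Fin n) k

pairCount : ∀ {N k n} → Array N k n → Fin k → Fin k → Fin n → Fin n → ℕ
pairCount {N} A i j x y =
  length (filter (λ r → (lookup (A r) i ≟ x) ×-dec (lookup (A r) j ≟ y)) (allFin N))

IsOA : (λ' k n : ℕ) → Array (λ' * (n * n)) k n → Set
IsOA λ' k n A = ∀ (i j : Fin k) → i ≢ j → ∀ (x y : Fin n) → pairCount A i j x y ≡ λ'

rowMultiplicity : ∀ {N k n} → Array N k n → Vec (Fin n) k → ℕ
rowMultiplicity {N} A v = length (filter (λ r → ≡-dec _≟_ (A r) v) (allFin N))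

module Submission where

-- Proof idea: a second-moment count (the argument of the paper).
-- Let A be an OA_λ(k,n) with N = λn² rows, v a row occurring m times, and
-- let a_r be the number of columns in which row r agrees with v.  Counting
-- agreements column by column, and pairs of agreements pair of columns by
-- pair of columns, the OA property gives the two moments
--     Σ_r a_r = knλ        and        Σ_r a_r² + kλ = k(k + n)λ.
-- With K = k - 1 and D = k(n - 1) + 1 they combine to Σ_r (n a_r - K)² = N D.
-- Every copy of v has a_r = k and contributes (nk - K)² = D², all other terms
-- are squares, so m D² ≤ N D, i.e. m D ≤ N.  Working in ℕ, the squares are
-- expanded: the per-row inequality reads 2nK a_r + [A r = v] D² ≤ n² a_r² + K²
-- (AM-GM) and the sum identity reads n² Σ a_r² + N K² = 2nK Σ a_r + N D.

open import Defs
open import Data.Nat using (ℕ; _*_; _+_; _∸_; _≤_; zero; suc; s≤s; z≤n; NonZero)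
open import Data.Nat.Properties
  using (+-*-semiring; +-comm; +-identityʳ; *-identityʳ; *-zeroʳ; *-assoc;
         +-mono-≤; ≤-reflexive; ≤-total; m≤m+n; m+[n∸m]≡n;
         +-cancelʳ-≡; +-cancelˡ-≤; *-cancelʳ-≤; module ≤-Reasoning)
open import Data.Nat.Tactic.RingSolver using (solve-∀)
open import Algebra.Properties.Semiring.Sum +-*-semiring
  using (sum; sum-syntax; sum-cong-≗; ∑-distrib-+; ∑-comm; *-distribˡ-sum; *-distribʳ-sum)
open import Data.Fin using (Fin; zero; suc)
open import Data.Fin.Properties using (_≟_; suc-injective)
open import Data.Vec using (Vec; lookup)
open import Data.Vec.Properties using (≡-dec)
open import Data.List using (length; filter; tabulate)
open import Data.Product using (Σ; _,_)
open import Data.Sum using (inj₁; inj₂)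
open import Relation.Nullary using (Dec; yes; no; ¬_; contradiction)
open import Relation.Nullary.Decidable using (_×-dec_)
open import Relation.Binary.PropositionalEquality
  using (_≡_; _≢_; refl; sym; trans; cong; cong₂; subst; subst₂; module ≡-Reasoning)

ind : ∀ {a} {P : Set a} → Dec P → ℕ
ind (yes _) = 1
ind (no _)  = 0

ind-yes : ∀ {a} {P : Set a} (d : Dec P) → P → ind d ≡ 1
ind-yes (yes _) _ = refl
ind-yes (no ¬p) p = contradiction p ¬p

ind-no : ∀ {a} {P : Set a} (d : Dec P) → ¬ P → ind d ≡ 0
ind-no (yes p) ¬p = contradiction p ¬p
ind-no (no _)  _  = refl

ind-⇔ : ∀ {a b} {P : Set a} {Q : Set b} → (P → Q) → (Q → P) →
        (d : Dec P) (e : Dec Q) → ind d ≡ ind e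
ind-⇔ to from (yes p) e = sym (ind-yes e (to p))
ind-⇔ to from (no ¬p) e = sym (ind-no e (λ q → ¬p (from q)))

ind-× : ∀ {a b} {P : Set a} {Q : Set b} (d : Dec P) (e : Dec Q) →
        ind (d ×-dec e) ≡ ind d * ind e
ind-× (yes _) (yes _) = refl
ind-× (yes _) (no _)  = refl
ind-× (no _)  _       = refl

ind-idem : ∀ {a} {P : Set a} (d : Dec P) → ind d * ind d ≡ ind d
ind-idem (yes _) = refl
ind-idem (no _)  = refl

∑-const : ∀ N c → ∑[ i < N ] c ≡ N * c
∑-const zero    c = refl
∑-const (suc N) c = cong (c +_) (∑-const N c)

∑-mono : ∀ {N} {f g : Fin N → ℕ} → (∀ i → f i ≤ g i) → sum f ≤ sum g
∑-mono {zero}  f≤g = z≤n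
∑-mono {suc N} f≤g = +-mono-≤ (f≤g zero) (∑-mono (λ i → f≤g (suc i)))

∑-delta : ∀ {k} (i : Fin k) → ∑[ j < k ] ind (i ≟ j) ≡ 1
∑-delta {suc k} zero = cong suc (begin
    ∑[ j < k ] ind (zero ≟ suc j) ≡⟨ sum-cong-≗ {k} (λ j → ind-no (zero ≟ suc j) (λ ())) ⟩
    ∑[ j < k ] 0                   ≡⟨ ∑-const k 0 ⟩
    k * 0                          ≡⟨ *-zeroʳ k ⟩
    0                              ∎)
  where open ≡-Reasoning
∑-delta {suc k} (suc i) = begin
    ind (suc i ≟ zero) + ∑[ j < k ] ind (suc i ≟ suc j)
      ≡⟨ cong₂ _+_ (ind-no (suc i ≟ zero) (λ ())) (sum-cong-≗ {k} shift) ⟩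
    ∑[ j < k ] ind (i ≟ j)
      ≡⟨ ∑-delta i ⟩
    1 ∎
  where
  open ≡-Reasoning
  shift : ∀ j → ind (suc i ≟ suc j) ≡ ind (i ≟ j)
  shift j = ind-⇔ suc-injective (cong suc) (suc i ≟ suc j) (i ≟ j)

∑-point : ∀ {k} (i : Fin k) (f : Fin k → ℕ) {a b} →
          f i ≡ a → (∀ j → i ≢ j → f j ≡ b) → sum f + b ≡ k * b + a
∑-point {k} i f {a} {b} at-i off-i = begin
    sum f + b
      ≡⟨ cong (sum f +_) (sym (scaled-delta b)) ⟩
    sum f + ∑[ j < k ] (ind (i ≟ j) * b)
      ≡⟨ sym (∑-distrib-+ f (λ j → ind (i ≟ j) * b)) ⟩
    ∑[ j < k ] (f j + ind (i ≟ j) * b)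
      ≡⟨ sum-cong-≗ {k} pointwise ⟩
    ∑[ j < k ] (b + ind (i ≟ j) * a)
      ≡⟨ ∑-distrib-+ (λ _ → b) (λ j → ind (i ≟ j) * a) ⟩
    ∑[ j < k ] b + ∑[ j < k ] (ind (i ≟ j) * a)
      ≡⟨ cong₂ _+_ (∑-const k b) (scaled-delta a) ⟩
    k * b + a ∎
  where
  open ≡-Reasoning
  scaled-delta : ∀ c → ∑[ j < k ] (ind (i ≟ j) * c) ≡ c
  scaled-delta c = begin
    ∑[ j < k ] (ind (i ≟ j) * c) ≡⟨ sym (*-distribʳ-sum c (λ j → ind (i ≟ j))) ⟩
    ∑[ j < k ] ind (i ≟ j) * c   ≡⟨ cong (_* c) (∑-delta i) ⟩
    1 * c                        ≡⟨ +-identityʳ c ⟩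
    c                            ∎
  pointwise : ∀ j → f j + ind (i ≟ j) * b ≡ b + ind (i ≟ j) * a
  pointwise j with i ≟ j
  ... | yes refl = trans (cong (_+ (b + 0)) at-i) (swap a b)
    where
    swap : ∀ a b → a + (b + 0) ≡ b + (a + 0)
    swap = solve-∀
  ... | no i≢j   = cong (_+ 0) (off-i j i≢j)

length-filter : ∀ {N p} {X : Set} {P : X → Set p} (P? : ∀ x → Dec (P x)) (f : Fin N → X) →
                length (filter P? (tabulate f)) ≡ ∑[ r < N ] ind (P? (f r))
length-filter {zero}  P? f = refl
length-filter {suc N} P? f with P? (f zero)
... | yes _ = cong suc (length-filter P? (λ r → f (suc r)))
... | no _  = length-filter P? (λ r → f (suc r))

-- AM-GM in ℕ, in the case x ≤ y written as y = x + d: the gap is d².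
am-gm-ordered : ∀ x d → 2 * x * (x + d) ≤ x * x + (x + d) * (x + d)
am-gm-ordered x d = subst (2 * x * (x + d) ≤_) (square x d) (m≤m+n _ (d * d))
  where
  square : ∀ x d → 2 * x * (x + d) + d * d ≡ x * x + (x + d) * (x + d)
  square = solve-∀

am-gm : ∀ x y → 2 * x * y ≤ x * x + y * y
am-gm x y with ≤-total x y
... | inj₁ x≤y = subst (λ t → 2 * x * t ≤ x * x + t * t) (m+[n∸m]≡n x≤y) (am-gm-ordered x (y ∸ x))
... | inj₂ y≤x = subst₂ _≤_ (swap y x) (+-comm (y * y) (x * x))
                   (subst (λ t → 2 * y * t ≤ y * y + t * t) (m+[n∸m]≡n y≤x) (am-gm-ordered y (x ∸ y)))
  where
  swap : ∀ a b → 2 * a * b ≡ 2 * b * a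
  swap = solve-∀

partner : ∀ {K} (i : Fin (suc (suc K))) → Σ (Fin (suc (suc K))) (i ≢_)
partner zero    = suc zero , λ ()
partner (suc i) = zero     , λ ()

-- Throughout, A is an OA_λ(k,n) all of whose columns have a partner column
-- (that is, k ≥ 2), and v is a fixed word of length k.
module Agreement {k n λ'} (A : Array (λ' * (n * n)) k n) (isOA : IsOA λ' k n A)
                 (partner : ∀ (i : Fin k) → Σ (Fin k) (i ≢_))
                 (v : Vec (Fin n) k) where

  N : ℕ
  N = λ' * (n * n)

  hit : Fin N → Fin k → Fin n → ℕ
  hit r i x = ind (lookup (A r) i ≟ x)

  pairCount-∑ : ∀ i j x y → pairCount A i j x y ≡ ∑[ r < N ] (hit r i x * hit r j y)
  pairCount-∑ i j x y =
    trans (length-filter (λ r → (lookup (A r) i ≟ x) ×-dec (lookup (A r) j ≟ y)) (λ r → r))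
          (sum-cong-≗ {N} (λ r → ind-× (lookup (A r) i ≟ x) (lookup (A r) j ≟ y)))

  -- Each symbol occurs nλ times in each column: sum the OA condition on a
  -- partner column j over the n possible symbols in column j.
  columnCount : ∀ i x → ∑[ r < N ] hit r i x ≡ n * λ'
  columnCount i x with partner i
  ... | j , i≢j = begin
      ∑[ r < N ] hit r i x
        ≡⟨ sum-cong-≗ {N} (λ r → sym (trans (cong (hit r i x *_) (∑-delta (lookup (A r) j)))
                                              (*-identityʳ _))) ⟩
      ∑[ r < N ] (hit r i x * ∑[ y < n ] hit r j y)
        ≡⟨ sum-cong-≗ {N} (λ r → *-distribˡ-sum (hit r i x) (λ y → hit r j y)) ⟩
      ∑[ r < N ] ∑[ y < n ] (hit r i x * hit r j y)
        ≡⟨ ∑-comm (λ r y → hit r i x * hit r j y) ⟩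
      ∑[ y < n ] ∑[ r < N ] (hit r i x * hit r j y)
        ≡⟨ sum-cong-≗ {n} (λ y → trans (sym (pairCount-∑ i j x y)) (isOA i j i≢j x y)) ⟩
      ∑[ y < n ] λ'
        ≡⟨ ∑-const n λ' ⟩
      n * λ' ∎
    where open ≡-Reasoning

  agree : Fin N → Fin k → ℕ
  agree r i = hit r i (lookup v i)

  agreement : Fin N → ℕ
  agreement r = ∑[ i < k ] agree r i

  agreement-copy : ∀ r → A r ≡ v → agreement r ≡ k
  agreement-copy r Ar≡v = begin
      ∑[ i < k ] agree r i ≡⟨ sum-cong-≗ {k} (λ i → ind-yes (lookup (A r) i ≟ lookup v i)
                                                            (cong (λ w → lookup w i) Ar≡v)) ⟩
      ∑[ i < k ] 1         ≡⟨ ∑-const k 1 ⟩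
      k * 1                ≡⟨ *-identityʳ k ⟩
      k                    ∎
    where open ≡-Reasoning

  firstMoment : ∑[ r < N ] agreement r ≡ k * (n * λ')
  firstMoment = begin
      ∑[ r < N ] ∑[ i < k ] agree r i ≡⟨ ∑-comm agree ⟩
      ∑[ i < k ] ∑[ r < N ] agree r i ≡⟨ sum-cong-≗ {k} (λ i → columnCount i (lookup v i)) ⟩
      ∑[ i < k ] (n * λ')            ≡⟨ ∑-const k (n * λ') ⟩
      k * (n * λ')                   ∎
    where open ≡-Reasoning

  coAgreement : Fin k → Fin k → ℕ
  coAgreement i j = ∑[ r < N ] (agree r i * agree r j)

  coAgreement-diag : ∀ i → coAgreement i i ≡ n * λ'
  coAgreement-diag i = trans (sum-cong-≗ {N} (λ r → ind-idem (lookup (A r) i ≟ lookup v i)))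
                             (columnCount i (lookup v i))

  coAgreement-off : ∀ i j → i ≢ j → coAgreement i j ≡ λ'
  coAgreement-off i j i≢j = trans (sym (pairCount-∑ i j (lookup v i) (lookup v j)))
                                  (isOA i j i≢j (lookup v i) (lookup v j))

  agreement² : ∀ r → agreement r * agreement r ≡ ∑[ i < k ] ∑[ j < k ] (agree r i * agree r j)
  agreement² r = trans (*-distribʳ-sum (agreement r) (agree r))
                       (sum-cong-≗ {k} (λ i → *-distribˡ-sum (agree r i) (agree r)))

  secondMoment : ∑[ r < N ] (agreement r * agreement r) + k * λ' ≡ k * (k * λ' + n * λ')
  secondMoment = begin
      ∑[ r < N ] (agreement r * agreement r) + k * λ'
        ≡⟨ cong₂ _+_ (sum-cong-≗ {N} agreement²) (sym (∑-const k λ')) ⟩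
      ∑[ r < N ] ∑[ i < k ] ∑[ j < k ] (agree r i * agree r j) + ∑[ i < k ] λ'
        ≡⟨ cong (_+ ∑[ i < k ] λ') (trans (∑-comm (λ r i → ∑[ j < k ] (agree r i * agree r j)))
                                          (sum-cong-≗ {k} (λ i → ∑-comm (λ r j → agree r i * agree r j)))) ⟩
      ∑[ i < k ] ∑[ j < k ] coAgreement i j + ∑[ i < k ] λ'
        ≡⟨ sym (∑-distrib-+ (λ i → ∑[ j < k ] coAgreement i j) (λ _ → λ')) ⟩
      ∑[ i < k ] (∑[ j < k ] coAgreement i j + λ')
        ≡⟨ sum-cong-≗ {k} (λ i → ∑-point i (coAgreement i) (coAgreement-diag i) (coAgreement-off i)) ⟩
      ∑[ i < k ] (k * λ' + n * λ')
        ≡⟨ ∑-const k (k * λ' + n * λ') ⟩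
      k * (k * λ' + n * λ') ∎
    where open ≡-Reasoning

-- In the next two lemmas k = K + 1, n = n' + 1 and D = k n' + 1 = k(n - 1) + 1.
-- Expanded form of (n a - K)² ≥ [a is a copy] D²: for a copy a = k and
-- (nk - K)² = D² exactly; otherwise this is AM-GM.
rowBound : ∀ K n' a {p} {P : Set p} (copy? : Dec P) → (P → a ≡ suc K) →
           2 * suc n' * K * a + ind copy? * ((suc K * n' + 1) * (suc K * n' + 1))
             ≤ suc n' * suc n' * (a * a) + K * K
rowBound K n' a (yes p) copy rewrite copy p = ≤-reflexive (square K n')
  where
  square : ∀ K n' → 2 * suc n' * K * suc K + 1 * ((suc K * n' + 1) * (suc K * n' + 1))
                      ≡ suc n' * suc n' * (suc K * suc K) + K * K
  square = solve-∀
rowBound K n' a (no _) _ = subst₂ _≤_ (regroupˡ (suc n') a K) (regroupʳ (suc n') a K) (am-gm (suc n' * a) K)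
  where
  regroupˡ : ∀ n a K → 2 * (n * a) * K ≡ 2 * n * K * a + 0
  regroupˡ = solve-∀
  regroupʳ : ∀ n a K → n * a * (n * a) + K * K ≡ n * n * (a * a) + K * K
  regroupʳ = solve-∀

-- Expanded form of Σ_r (n a_r - K)² = N D: given the second moment S₂ of the
-- agreement (and its first moment knλ), n² S₂ + N K² = 2nK·knλ + N D.
sumOfSquares : ∀ K n' λ' S₂ → S₂ + suc K * λ' ≡ suc K * (suc K * λ' + suc n' * λ') →
               suc n' * suc n' * S₂ + λ' * (suc n' * suc n') * (K * K)
                 ≡ 2 * suc n' * K * (suc K * (suc n' * λ')) + λ' * (suc n' * suc n') * (suc K * n' + 1)
sumOfSquares K n' λ' S₂ secondMoment = +-cancelʳ-≡ (suc n' * suc n' * (suc K * λ')) _ _ (begin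
    suc n' * suc n' * S₂ + λ' * (suc n' * suc n') * (K * K) + suc n' * suc n' * (suc K * λ')
      ≡⟨ factor (suc n' * suc n') S₂ (λ' * (suc n' * suc n') * (K * K)) (suc K * λ') ⟩
    suc n' * suc n' * (S₂ + suc K * λ') + λ' * (suc n' * suc n') * (K * K)
      ≡⟨ cong (λ t → suc n' * suc n' * t + λ' * (suc n' * suc n') * (K * K)) secondMoment ⟩
    suc n' * suc n' * (suc K * (suc K * λ' + suc n' * λ')) + λ' * (suc n' * suc n') * (K * K)
      ≡⟨ expand K n' λ' ⟩
    2 * suc n' * K * (suc K * (suc n' * λ')) + λ' * (suc n' * suc n') * (suc K * n' + 1)
      + suc n' * suc n' * (suc K * λ') ∎)
  where
  open ≡-Reasoning
  factor : ∀ a s b q → a * s + b + a * q ≡ a * (s + q) + b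
  factor = solve-∀
  expand : ∀ K n' λ' →
    suc n' * suc n' * (suc K * (suc K * λ' + suc n' * λ')) + λ' * (suc n' * suc n') * (K * K)
      ≡ 2 * suc n' * K * (suc K * (suc n' * λ')) + λ' * (suc n' * suc n') * (suc K * n' + 1)
        + suc n' * suc n' * (suc K * λ')
  expand = solve-∀

nonZero-+1 : ∀ x → NonZero (x + 1)
nonZero-+1 x rewrite +-comm x 1 = _

module RepeatedRow {K₀ n' λ'} (A : Array (λ' * (suc n' * suc n')) (suc (suc K₀)) (suc n'))
                   (isOA : IsOA λ' (suc (suc K₀)) (suc n') A) (r₀ : Fin (λ' * (suc n' * suc n'))) where

  open Agreement A isOA partner (A r₀)

  k K n D : ℕ
  k = suc (suc K₀)
  K = suc K₀
  n = suc n'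
  D = k * n' + 1

  copy? : (r : Fin N) → Dec (A r ≡ A r₀)
  copy? r = ≡-dec _≟_ (A r) (A r₀)

  copies : ∑[ r < N ] ind (copy? r) ≡ rowMultiplicity A (A r₀)
  copies = sym (length-filter copy? (λ r → r))

  copiesBound : 2 * n * K * (k * (n * λ')) + rowMultiplicity A (A r₀) * (D * D)
                  ≤ 2 * n * K * (k * (n * λ')) + N * D
  copiesBound = begin
      2 * n * K * (k * (n * λ')) + rowMultiplicity A (A r₀) * (D * D)
        ≡⟨ cong₂ _+_ (cong (2 * n * K *_) (sym firstMoment)) (cong (_* (D * D)) (sym copies)) ⟩
      2 * n * K * ∑[ r < N ] agreement r + ∑[ r < N ] ind (copy? r) * (D * D)
        ≡⟨ cong₂ _+_ (*-distribˡ-sum (2 * n * K) agreement) (*-distribʳ-sum (D * D) (λ r → ind (copy? r))) ⟩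
      ∑[ r < N ] (2 * n * K * agreement r) + ∑[ r < N ] (ind (copy? r) * (D * D))
        ≡⟨ sym (∑-distrib-+ (λ r → 2 * n * K * agreement r) (λ r → ind (copy? r) * (D * D))) ⟩
      ∑[ r < N ] (2 * n * K * agreement r + ind (copy? r) * (D * D))
        ≤⟨ ∑-mono (λ r → rowBound K n' (agreement r) (copy? r) (agreement-copy r)) ⟩
      ∑[ r < N ] (n * n * (agreement r * agreement r) + K * K)
        ≡⟨ ∑-distrib-+ (λ r → n * n * (agreement r * agreement r)) (λ _ → K * K) ⟩
      ∑[ r < N ] (n * n * (agreement r * agreement r)) + ∑[ r < N ] (K * K)
        ≡⟨ cong₂ _+_ (sym (*-distribˡ-sum (n * n) (λ r → agreement r * agreement r))) (∑-const N (K * K)) ⟩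
      n * n * ∑[ r < N ] (agreement r * agreement r) + N * (K * K)
        ≡⟨ sumOfSquares K n' λ' _ secondMoment ⟩
      2 * n * K * (k * (n * λ')) + N * D ∎
    where open ≤-Reasoning

corollary2p3 : (k n λ' m : ℕ) → 2 ≤ k → 2 ≤ n → 1 ≤ λ' → 1 ≤ m →
    (A : Array (λ' * (n * n)) k n) → IsOA λ' k n A →
    Σ (Fin (λ' * (n * n))) (λ r → rowMultiplicity A (A r) ≡ m) →
    m * (k * (n ∸ 1) + 1) ≤ λ' * (n * n)
corollary2p3 (suc (suc K₀)) (suc n') λ' m (s≤s (s≤s _)) (s≤s _) _ _ A isOA (r₀ , multiplicity) =
  *-cancelʳ-≤ (m * D) N D {{nonZero-+1 (k * n')}}
    (subst (_≤ N * D) (sym (*-assoc m D D))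
      (+-cancelˡ-≤ (2 * n * K * (k * (n * λ'))) _ _
        (subst (λ t → 2 * n * K * (k * (n * λ')) + t * (D * D) ≤ _) multiplicity copiesBound)))
  where
  open RepeatedRow A isOA r₀
  N = λ' * (n * n)
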